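{- Let $\mathfrak{m}=(\pi,S)$ be a marked perfect matching with respect to $(n_1,\dots,n_k)$ that has at least one homogeneous edge. If $\Phi(\mathfrak{m})=(\pi,S\triangle\{e\})$, then the edge $e$ is convertible in $\mathfrak{m}$.
   Context: Fix positive integers $n_1,\dots,n_k$ and $N=n_1+\dots+n_k$. Let $\pi$ be a permutation of $[N]$, viewed as a perfect matching with edges $e_i=(i,\overline{\pi(i)})$. An edge $e_i$ is homogeneous if $n_1+\dots+n_{r-1}+1\le i,\pi(i)\le n_1+\dots+n_r$ for some $r\in[k]$, inhomogeneous otherwise; $E^H(\pi)$ is the set of homogeneous edges. A marked perfect matching is a pair $\mathfrak{m}=(\pi,S)$ with $S$ a set of edges of $\pi$ containing all inhomogeneous edges (edges in $S$ are marked). $\mathrm{bind}^U_{\mathfrak{m}}(i)$ is $1$ plus the number of $u<i$ with $e_u\in S$; $\mathrm{bind}^L_{\mathfrak{m}}(j)$ is $1$ plus the number of $v<j$ such that the edge with lower endpoint $\bar v$ is in $S$; $\mathrm{bdiff}_{\mathfrak{m}}(e_i)=\mathrm{bind}^L_{\mathfrak{m}}(\pi(i))-\mathrm{bind}^U_{\mathfrak{m}}(i)$. Two edges $e_a,e_b$ cross if $(a-b)(\pi(a)-\pi(b))<0$; $e_j$ crosses $e_i$ from the left (equivalently $e_i$ crosses $e_j$ from the right) if $j<i$ and $\pi(j)>\pi(i)$. A homogeneous edge $e$ is convertible in $\mathfrak{m}$ if: when $e\notin S$, every edge $e'$ crossing $e$ either crosses $e$ from the left with $\mathrm{bdiff}_{\mathfrak{m}}(e')\ge0$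 or crosses $e$ from the right with $\mathrm{bdiff}_{\mathfrak{m}}(e')\le-1$; when $e\in S$, every edge $e'$ crossing $e$ either crosses $e$ from the left with $\mathrm{bdiff}_{\mathfrak{m}}(e')>0$ or crosses $e$ from the right with $\mathrm{bdiff}_{\mathfrak{m}}(e')<-1$. $\triangle$ denotes symmetric difference. The map $\Phi$ on marked perfect matchings is defined as follows. Case 0: if $E^H(\pi)=\emptyset$, $\Phi(\mathfrak{m})=\mathfrak{m}$. Case 1: if $E^H(\pi)\ne\emptyset$ and $\mathrm{bdiff}_{\mathfrak{m}}(e)\ge0$ for all $e\in E^H(\pi)$, then $\Phi(\mathfrak{m})=(\pi,S\triangle\{e_i\})$ where $\pi(i)=\min\{\pi(j):e_j\in E^H(\pi)\}$. Case 2: otherwise let $i=\min\{j: e_j\in E^H(\pi),\ \mathrm{bdiff}_{\mathfrak{m}}(e_j)<0\}$; (a) if $e_i$ is convertible in $\mathfrak{m}$, $\Phi(\mathfrak{m})=(\pi,S\triangle\{e_i\})$; (b) if not, $\Phi(\mathfrak{m})=(\pi,S\triangle\{e_{i'}\})$ with $i'=\max\{j<i: e_j\in E^H(\pi),\ \mathrm{bdiff}_{\mathfrak{m}}(e_j)=0,\ e_j\text{ crosses } e_i\}$ (this set is nonempty in case (b), so $\Phi$ is well defined). -}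

module Defs where

open import Data.Nat using (ℕ; zero; suc; _+_; _≤_; _<_; _>_)
open import Data.Fin using (Fin; toℕ)
open import Data.Fin.Permutation using (Permutation′; _⟨$⟩ʳ_; _⟨$⟩ˡ_)
open import Data.Fin.Subset using (Subset; _∈_; _∉_; ⁅_⁆)
open import Data.Fin.Subset.Properties using (_∈?_)
open import Data.Nat.ListAction using (sum)
open import Data.List using (List; take; length; filter; allFin)
open import Data.List.Relation.Unary.All using (All)
open import Data.Vec using (zipWith)
open import Data.Bool using (_xor_)
open import Data.Integer as ℤ using (ℤ; +_; -[1+_])
open import Data.Product using (Σ; Σ-syntax; ∃; ∃-syntax; _×_)
open import Data.Sum using (_⊎_)
open import Relation.Nullary using (¬_)
open import Relation.Nullary.Decidable using (_×-dec_)
open import Relation.Binary.PropositionalEquality using (_≡_)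

-- A composition (n₁,…,n_k): a list of positive integers; N = n₁+⋯+n_k.
-- Positions are 0-based: position p ∈ Fin N corresponds to p+1 ∈ [N].
record Composition : Set where
  field
    parts    : List ℕ
    positive : All (λ n → 1 ≤ n) parts

  N : ℕ
  N = sum parts

  offset : ℕ → ℕ
  offset r = sum (take r parts)

open Composition public

-- Edge e_i = (i, π(i)) is homogeneous iff both endpoints lie in the same block
-- [n₁+⋯+n_{r-1}+1, n₁+⋯+n_r] (here 0-based: [offset r, offset (r+1)) ).
Homogeneous : (c : Composition) → Permutation′ (N c) → Fin (N c) → Set
Homogeneous c π i =
  Σ[ r ∈ ℕ ] (r < length (parts c)
    × (offset c r ≤ toℕ i × toℕ i < offset c (suc r))
    × (offset c r ≤ toℕ (π ⟨$⟩ʳ i) × toℕ (π ⟨$⟩ʳ i) < offset c (suc r)))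

-- Marked perfect matching: S is a set of edges (edge e_i is identified with i)
-- containing every inhomogeneous edge.
record Marked (c : Composition) : Set where
  constructor mkMarked
  field
    perm  : Permutation′ (N c)
    marks : Subset (N c)
    inhomMarked : ∀ i → ¬ Homogeneous c perm i → i ∈ marks

open Marked public

module _ {c : Composition} (m : Marked c) where
  private
    n = N c
    π = perm m
    S = marks m

  πf : Fin n → Fin n
  πf i = π ⟨$⟩ʳ i

  bindU : Fin n → ℕ
  bindU i = suc (length (filter (λ u → (toℕ u Data.Nat.<? toℕ i) ×-dec (u ∈? S)) (allFin n)))

  bindL : Fin n → ℕ
  bindL j = suc (length (filter (λ v → (toℕ v Data.Nat.<? toℕ j) ×-dec ((π ⟨$⟩ˡ v) ∈? S)) (allFin n)))

  bdiff : Fin n → ℤ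
  bdiff i = (+ bindL (πf i)) ℤ.- (+ bindU i)

  CrossesFromLeft : Fin n → Fin n → Set
  CrossesFromLeft j i = toℕ j < toℕ i × toℕ (πf j) > toℕ (πf i)

  CrossesFromRight : Fin n → Fin n → Set
  CrossesFromRight j i = CrossesFromLeft i j

  Crosses : Fin n → Fin n → Set
  Crosses a b = CrossesFromLeft a b ⊎ CrossesFromRight a b

  Convertible : Fin n → Set
  Convertible i = Homogeneous c π i ×
    ((i ∉ S → ∀ j → Crosses j i →
        (CrossesFromLeft j i × (+ 0) ℤ.≤ bdiff j)
      ⊎ (CrossesFromRight j i × bdiff j ℤ.≤ -[1+ 0 ]))
    × (i ∈ S → ∀ j → Crosses j i →
        (CrossesFromLeft j i × (+ 0) ℤ.< bdiff j)
      ⊎ (CrossesFromRight j i × bdiff j ℤ.< -[1+ 0 ])))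

  -- the edge toggled by Φ in cases 1, 2(a), 2(b) (specified by its
  -- defining min/max properties)
  data PhiEdge : Fin n → Set where
    case1 : ∀ i →
      (∀ j → Homogeneous c π j → (+ 0) ℤ.≤ bdiff j) →
      Homogeneous c π i →
      (∀ j → Homogeneous c π j → toℕ (πf i) ≤ toℕ (πf j)) →
      PhiEdge i
    case2a : ∀ i →
      Homogeneous c π i → bdiff i ℤ.< + 0 →
      (∀ j → toℕ j < toℕ i → Homogeneous c π j → ¬ (bdiff j ℤ.< + 0)) →
      Convertible i →
      PhiEdge i
    case2b : ∀ i i′ →
      Homogeneous c π i → bdiff i ℤ.< + 0 →
      (∀ j → toℕ j < toℕ i → Homogeneous c π j → ¬ (bdiff j ℤ.< + 0)) →
      ¬ Convertible i →
      (toℕ i′ < toℕ i × Homogeneous c π i′ × bdiff i′ ≡ + 0 × Crosses i′ i) →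
      (∀ j → toℕ j < toℕ i → Homogeneous c π j → bdiff j ≡ + 0 → Crosses j i →
         toℕ j ≤ toℕ i′) →
      PhiEdge i′

_△_ : ∀ {n} → Subset n → Subset n → Subset n
_△_ = zipWith _xor_

-- Φ(m) = (π, S′)  (the permutation is never changed by Φ)
data Φ≡ {c : Composition} (m : Marked c) : Subset (N c) → Set where
  case0 : (∀ i → ¬ Homogeneous c (perm m) i) → Φ≡ m (marks m)
  toggle : ∀ x → PhiEdge m x → Φ≡ m (marks m △ ⁅ x ⁆)

-- Let U(t) and L(t) count the marked edges whose upper, resp. lower, endpoint
-- lies before position t, so that bdiff(e_j) = L(π j) − U(j).  Unmarked edges
-- are homogeneous and do not leave their block, so U and L agree at every block
-- boundary; each bound on bdiff of an edge crossing e then follows by comparing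
-- U and L through the boundaries of the block of e.  In case 1 every edge
-- crossing e from the right ends below all homogeneous edges and is therefore
-- marked.  In case 2(b), e_i is marked (an unmarked first negative edge is
-- convertible), U = L at e_{i'} because bdiff(e_{i'}) = 0, and the maximality
-- of i' excludes the one unmarked right crossing of e_{i'} that these
-- estimates do not control.
module Submission where

open import Defs
open import Level using (0ℓ)
open import Data.Bool using (true; false; if_then_else_)
open import Data.Nat using (ℕ; zero; suc; _+_; _≤_; _<_; z≤n; s≤s; s≤s⁻¹; _<?_; _≤?_)
open import Data.Nat.Properties
  using (≤-refl; ≤-trans; <-trans; <-≤-trans; ≤-<-trans; <⇒≤; <⇒≱; <-asym; ≰⇒>; ≮⇒≥; ≤∧≢⇒<;
         +-cancelʳ-≡; +-suc; suc-injective; ≤-reflexive; ≤-antisym; +-monoʳ-≤; m<n⇒0<n∸m; m+n≤o⇒m≤o∸n; m≤n⇒m≤1+n; n≤1+n)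
open import Data.Nat.ListAction using (sum)
open import Data.Integer as ℤ using (+_; 0ℤ; -1ℤ; +≤+; +<+)
open import Data.Integer.Properties as ℤ
  using ([+m]-[+n]≡m⊖n; ⊖-≥; ⊖-<; neg-mono-≤; neg-mono-<; drop‿+≤+; 0≤i-j⇒j≤i; i-j≡0⇒i≡j;
         i≡j⇒i-j≡0; +-injective)
open import Data.List using (List; []; _∷_; take; length; filter; tabulate; allFin)
open import Data.List.Properties using (filter-≐; filter-accept; filter-reject)
open import Data.List.Relation.Unary.Any using (here; there)
open import Data.List.Membership.Propositional using () renaming (_∈_ to _∈ₗ_)
open import Data.List.Membership.Propositional.Properties using (∈-allFin)
open import Data.List.Relation.Binary.Sublist.Propositional using (⊆-refl)
open import Data.List.Relation.Binary.Sublist.Propositional.Properties using (filter⁺; length-mono-≤)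
open import Data.Fin using (Fin; zero; suc; toℕ)
open import Data.Fin.Properties using (toℕ-injective)
open import Data.Fin.Permutation using (Permutation′; _⟨$⟩ʳ_; _⟨$⟩ˡ_; inverseˡ)
open import Data.Fin.Subset using (Subset; _∈_; _∉_; ⁅_⁆)
open import Data.Fin.Subset.Properties using (_∈?_)
open import Data.Vec using (_∷_)
open import Data.Vec.Properties using (∷-injectiveʳ)
open import Data.Product using (_×_; _,_; proj₁; proj₂; ∃)
open import Data.Sum using (inj₁; inj₂; [_,_])
open import Data.Empty using (⊥-elim)
open import Function using (_∘_)
open import Algebra.Properties.CommutativeMonoid.Sum Data.Nat.Properties.+-0-commutativeMonoid
  using () renaming (sum to ∑; sum-permute to ∑-permute)
open import Relation.Nullary using (¬_; yes; no; does)
open import Relation.Nullary.Decidable using (_×-dec_; ¬?; decidable-stable)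
open import Relation.Unary using (Pred; Decidable; _⊆_; _≐_)
open import Relation.Binary.PropositionalEquality
  using (_≡_; _≢_; refl; sym; trans; cong; cong₂; subst; module ≡-Reasoning)

module _ {A : Set} {P Q : Pred A 0ℓ} (P? : Decidable P) (Q? : Decidable Q) where

  length-filter-mono : P ⊆ Q → ∀ xs → length (filter P? xs) ≤ length (filter Q? xs)
  length-filter-mono P⊆Q xs = length-mono-≤ (filter⁺ P? Q? (λ { refl → P⊆Q }) (⊆-refl {x = xs}))

  length-filter-mono-< : P ⊆ Q → ∀ {x xs} → Q x → ¬ P x → x ∈ₗ xs →
                         length (filter P? xs) < length (filter Q? xs)
  length-filter-mono-< P⊆Q {xs = _ ∷ xs} Qx ¬Px (here refl)
    rewrite filter-reject P? {xs = xs} ¬Px | filter-accept Q? {xs = xs} Qx = s≤s (length-filter-mono P⊆Q xs)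
  length-filter-mono-< P⊆Q {xs = y ∷ xs} Qx ¬Px (there x∈xs) with P? y | Q? y
  ... | yes _  | yes _  = s≤s (length-filter-mono-< P⊆Q Qx ¬Px x∈xs)
  ... | yes Py | no ¬Qy = ⊥-elim (¬Qy (P⊆Q Py))
  ... | no _   | yes _  = m≤n⇒m≤1+n (length-filter-mono-< P⊆Q Qx ¬Px x∈xs)
  ... | no _   | no _   = length-filter-mono-< P⊆Q Qx ¬Px x∈xs

  length-filter-≐ : P ≐ Q → ∀ xs → length (filter P? xs) ≡ length (filter Q? xs)
  length-filter-≐ P≐Q xs = cong length (filter-≐ P? Q? P≐Q xs)

  length-filter-split : ∀ xs → length (filter P? xs) ≡
    length (filter (λ x → P? x ×-dec Q? x) xs) + length (filter (λ x → P? x ×-dec ¬? (Q? x)) xs)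
  length-filter-split [] = refl
  length-filter-split (x ∷ xs) with P? x | Q? x
  ... | yes _ | yes _ = cong suc (length-filter-split xs)
  ... | yes _ | no _  = trans (cong suc (length-filter-split xs)) (sym (+-suc _ _))
  ... | no _  | yes _ = length-filter-split xs
  ... | no _  | no _  = length-filter-split xs

module _ {A : Set} {P : Pred A 0ℓ} (P? : Decidable P) where

  length-filter-tabulate : ∀ {n} (f : Fin n → A) →
    length (filter P? (tabulate f)) ≡ ∑ (λ i → if does (P? (f i)) then 1 else 0)
  length-filter-tabulate {zero}  f = refl
  length-filter-tabulate {suc n} f with P? (f zero)
  ... | yes _ = cong suc (length-filter-tabulate (λ i → f (suc i)))
  ... | no _  = length-filter-tabulate (λ i → f (suc i))

length-filter-permute : ∀ {n} (π : Permutation′ n) {P : Pred (Fin n) 0ℓ} (P? : Decidable P) →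
  length (filter (λ i → P? (π ⟨$⟩ʳ i)) (allFin n)) ≡ length (filter P? (allFin n))
length-filter-permute {n} π P? = begin
  length (filter (λ i → P? (π ⟨$⟩ʳ i)) (allFin n)) ≡⟨ length-filter-tabulate (λ i → P? (π ⟨$⟩ʳ i)) (λ i → i) ⟩
  ∑ (λ i → indicator (π ⟨$⟩ʳ i))                  ≡⟨ ∑-permute indicator π ⟨
  ∑ indicator                                      ≡⟨ length-filter-tabulate P? (λ i → i) ⟨
  length (filter P? (allFin n))                    ∎
  where
  open ≡-Reasoning
  indicator = λ i → if does (P? i) then 1 else 0

n≤m⇒0≤+m-+n : ∀ {m n} → n ≤ m → 0ℤ ℤ.≤ + m ℤ.- + n
n≤m⇒0≤+m-+n {m} {n} n≤m rewrite [+m]-[+n]≡m⊖n m n | ⊖-≥ n≤m = +≤+ z≤n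

n<m⇒0<+m-+n : ∀ {m n} → n < m → 0ℤ ℤ.< + m ℤ.- + n
n<m⇒0<+m-+n {m} {n} n<m rewrite [+m]-[+n]≡m⊖n m n | ⊖-≥ (<⇒≤ n<m) = +<+ (m<n⇒0<n∸m n<m)

m<n⇒+m-+n≤-1 : ∀ {m n} → m < n → + m ℤ.- + n ℤ.≤ -1ℤ
m<n⇒+m-+n≤-1 {m} {n} m<n rewrite [+m]-[+n]≡m⊖n m n | ⊖-< m<n = neg-mono-≤ (+≤+ (m<n⇒0<n∸m m<n))

2+m≤n⇒+m-+n<-1 : ∀ {m n} → 2 + m ≤ n → + m ℤ.- + n ℤ.< -1ℤ
2+m≤n⇒+m-+n<-1 {m} {n} 2+m≤n rewrite [+m]-[+n]≡m⊖n m n | ⊖-< (≤-trans (n≤1+n _) 2+m≤n) =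
  neg-mono-< (+<+ (m+n≤o⇒m≤o∸n 2 2+m≤n))

0≤+m-+n⇒n≤m : ∀ {m n} → 0ℤ ℤ.≤ + m ℤ.- + n → n ≤ m
0≤+m-+n⇒n≤m 0≤m-n = drop‿+≤+ (0≤i-j⇒j≤i 0≤m-n)

+m-+n<0⇒m<n : ∀ {m n} → + m ℤ.- + n ℤ.< 0ℤ → m < n
+m-+n<0⇒m<n m-n<0 = ≰⇒> (λ n≤m → ℤ.<⇒≱ m-n<0 (n≤m⇒0≤+m-+n n≤m))

sum-take-mono : ∀ (xs : List ℕ) {r s} → r ≤ s → sum (take r xs) ≤ sum (take s xs)
sum-take-mono xs       {zero}          _         = z≤n
sum-take-mono []       {suc r} {suc s} _         = z≤n
sum-take-mono (x ∷ xs) {suc r} {suc s} (s≤s r≤s) = +-monoʳ-≤ x (sum-take-mono xs r≤s)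

below-offset-transfer : ∀ (xs : List ℕ) {r t x y} →
  sum (take r xs) ≤ x → y < sum (take (suc r) xs) → x < sum (take t xs) → y < sum (take t xs)
below-offset-transfer xs {r} {t} r≤x y<r+1 x<t with suc r ≤? t
... | yes r<t = <-≤-trans y<r+1 (sum-take-mono xs r<t)
... | no r≮t  = ⊥-elim (<⇒≱ x<t (≤-trans (sum-take-mono xs (s≤s⁻¹ (≰⇒> r≮t))) r≤x))

module _ {c : Composition} (m : Marked c) where
  private
    π = perm m
    S = marks m

    #_ : {P : Pred (Fin (N c)) 0ℓ} → Decidable P → ℕ
    # P? = length (filter P? (allFin (N c)))

  lowerEnd : Fin (N c) → ℕ
  lowerEnd i = toℕ (πf m i)

  -- bindU m i ≡ suc (upperMarks (toℕ i)) and bindL m j ≡ suc (lowerMarks (toℕ j)) definitionally.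
  upperMarks : ℕ → ℕ
  upperMarks t = # (λ u → (toℕ u <? t) ×-dec (u ∈? S))

  lowerMarks : ℕ → ℕ
  lowerMarks t = # (λ v → (toℕ v <? t) ×-dec ((π ⟨$⟩ˡ v) ∈? S))

  lowerEnd-injective : ∀ {i j} → lowerEnd i ≡ lowerEnd j → i ≡ j
  lowerEnd-injective {i} {j} eq = begin
    i                     ≡⟨ inverseˡ π ⟨
    π ⟨$⟩ˡ (π ⟨$⟩ʳ i)     ≡⟨ cong (π ⟨$⟩ˡ_) (toℕ-injective eq) ⟩
    π ⟨$⟩ˡ (π ⟨$⟩ʳ j)     ≡⟨ inverseˡ π ⟩
    j                     ∎
    where open ≡-Reasoning

  upperMarks-mono : ∀ {s t} → s ≤ t → upperMarks s ≤ upperMarks t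
  upperMarks-mono s≤t = length-filter-mono _ _ (λ (u<s , u∈S) → <-≤-trans u<s s≤t , u∈S) (allFin (N c))

  lowerMarks-mono : ∀ {s t} → s ≤ t → lowerMarks s ≤ lowerMarks t
  lowerMarks-mono s≤t = length-filter-mono _ _ (λ (v<s , v∈S) → <-≤-trans v<s s≤t , v∈S) (allFin (N c))

  upperMarks-step : ∀ {x s t} → x ∈ S → s ≤ toℕ x → toℕ x < t → upperMarks s < upperMarks t
  upperMarks-step {x} x∈S s≤x x<t =
    length-filter-mono-< _ _ (λ (u<s , u∈S) → <-trans u<s (≤-<-trans s≤x x<t) , u∈S)
      (x<t , x∈S) (λ (x<s , _) → <⇒≱ x<s s≤x) (∈-allFin x)

  lowerMarks-step : ∀ {x s t} → x ∈ S → s ≤ lowerEnd x → lowerEnd x < t → lowerMarks s < lowerMarks t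
  lowerMarks-step {x} x∈S s≤x x<t =
    length-filter-mono-< _ _ (λ (v<s , v∈S) → <-trans v<s (≤-<-trans s≤x x<t) , v∈S)
      (x<t , subst (_∈ S) (sym (inverseˡ π)) x∈S) (λ (x<s , _) → <⇒≱ x<s s≤x) (∈-allFin (π ⟨$⟩ʳ x))

  unmarked-below-offset : ∀ {u} t → u ∉ S → toℕ u < offset c t → lowerEnd u < offset c t
  unmarked-below-offset {u} t u∉S u<t = decidable-stable (lowerEnd u <? offset c t) λ pu≮t →
    u∉S (inhomMarked m u λ (_ , _ , (r≤u , _) , (_ , pu<r+1)) →
      pu≮t (below-offset-transfer (parts c) {t = t} r≤u pu<r+1 u<t))

  unmarked-lowerEnd-below-offset : ∀ {u} t → u ∉ S → lowerEnd u < offset c t → toℕ u < offset c t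
  unmarked-lowerEnd-below-offset {u} t u∉S pu<t = decidable-stable (toℕ u <? offset c t) λ u≮t →
    u∉S (inhomMarked m u λ (_ , _ , (_ , u<r+1) , (r≤pu , _)) →
      u≮t (below-offset-transfer (parts c) {t = t} r≤pu u<r+1 pu<t))

  upperMarks≡lowerMarks-offset : ∀ r → upperMarks (offset c r) ≡ lowerMarks (offset c r)
  upperMarks≡lowerMarks-offset r = +-cancelʳ-≡ _ _ _ (begin
    upperMarks t + # upperUnmarked                    ≡⟨ length-filter-split upper? (_∈? S) (allFin (N c)) ⟨
    # upper?                                          ≡⟨ length-filter-permute π upper? ⟨
    # lower?                                          ≡⟨ length-filter-split lower? (_∈? S) (allFin (N c)) ⟩
    # (λ u → lower? u ×-dec (u ∈? S)) + # lowerUnmarked ≡⟨ cong₂ _+_ lowerMarks-by-edges unmarked-agree ⟩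
    lowerMarks t + # upperUnmarked                    ∎)
    where
    open ≡-Reasoning
    t = offset c r
    upper? = λ u → toℕ u <? t
    lower? = λ u → lowerEnd u <? t
    upperUnmarked = λ u → upper? u ×-dec ¬? (u ∈? S)
    lowerUnmarked = λ u → lower? u ×-dec ¬? (u ∈? S)
    lowerMarks-by-edges : # (λ u → lower? u ×-dec (u ∈? S)) ≡ lowerMarks t
    lowerMarks-by-edges = trans
      (length-filter-≐ (λ u → lower? u ×-dec (u ∈? S))
                       (λ u → (toℕ (π ⟨$⟩ʳ u) <? t) ×-dec ((π ⟨$⟩ˡ (π ⟨$⟩ʳ u)) ∈? S))
        ( (λ (pu<t , u∈S) → pu<t , subst (_∈ S) (sym (inverseˡ π)) u∈S)
        , (λ (pu<t , u∈S) → pu<t , subst (_∈ S) (inverseˡ π) u∈S))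
        (allFin (N c)))
      (length-filter-permute π (λ v → (toℕ v <? t) ×-dec ((π ⟨$⟩ˡ v) ∈? S)))
    unmarked-agree : # lowerUnmarked ≡ # upperUnmarked
    unmarked-agree = length-filter-≐ lowerUnmarked upperUnmarked
      ( (λ (pu<t , u∉S) → unmarked-lowerEnd-below-offset r u∉S pu<t , u∉S)
      , (λ (u<t , u∉S) → unmarked-below-offset r u∉S u<t , u∉S)) (allFin (N c))

  upperMarks≤lowerMarks-across-offset : ∀ r {s t} → s ≤ offset c r → offset c r ≤ t →
    upperMarks s ≤ lowerMarks t
  upperMarks≤lowerMarks-across-offset r s≤a a≤t = ≤-trans (upperMarks-mono s≤a)
    (≤-trans (≤-reflexive (upperMarks≡lowerMarks-offset r)) (lowerMarks-mono a≤t))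

  -- Convertibility of e, with each bound on bdiff(e_j) = lowerMarks (π j) − upperMarks j
  -- moved to the natural numbers.
  LeftMargin : Fin (N c) → Fin (N c) → Set
  LeftMargin e j = upperMarks (toℕ j) ≤ lowerMarks (lowerEnd j)
                 × (e ∈ S → upperMarks (toℕ j) < lowerMarks (lowerEnd j))

  RightMargin : Fin (N c) → Fin (N c) → Set
  RightMargin e j = lowerMarks (lowerEnd j) < upperMarks (toℕ j)
                  × (e ∈ S → 2 + lowerMarks (lowerEnd j) ≤ upperMarks (toℕ j))

  convertible-from-margins : ∀ {e} → Homogeneous c π e →
    (∀ j → CrossesFromLeft m j e → LeftMargin e j) →
    (∀ j → CrossesFromRight m j e → RightMargin e j) →
    Convertible m e
  convertible-from-margins hom left right = hom , unmarked , marked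
    where
    unmarked = λ where
      _ j (inj₁ j↘e) → inj₁ (j↘e , n≤m⇒0≤+m-+n (s≤s (proj₁ (left j j↘e))))
      _ j (inj₂ e↘j) → inj₂ (e↘j , m<n⇒+m-+n≤-1 (s≤s (proj₁ (right j e↘j))))
    marked = λ where
      e∈S j (inj₁ j↘e) → inj₁ (j↘e , n<m⇒0<+m-+n (s≤s (proj₂ (left j j↘e) e∈S)))
      e∈S j (inj₂ e↘j) → inj₂ (e↘j , 2+m≤n⇒+m-+n<-1 (s≤s (proj₂ (right j e↘j) e∈S)))

  balanced-left-margins : ∀ {e} → upperMarks (toℕ e) ≤ lowerMarks (lowerEnd e) →
    ∀ j → CrossesFromLeft m j e → LeftMargin e j
  balanced-left-margins U≤L j (j<e , pe<pj) =
      ≤-trans Uj≤Le (lowerMarks-mono (<⇒≤ pe<pj))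
    , λ e∈S → ≤-<-trans Uj≤Le (lowerMarks-step e∈S ≤-refl pe<pj)
    where Uj≤Le = ≤-trans (upperMarks-mono (<⇒≤ j<e)) U≤L

  case1-convertible : ∀ {i} → (∀ j → Homogeneous c π j → 0ℤ ℤ.≤ bdiff m j) →
    Homogeneous c π i → (∀ j → Homogeneous c π j → lowerEnd i ≤ lowerEnd j) →
    Convertible m i
  case1-convertible {i} nonneg homᵢ@(r , r<k , (a≤i , i<b) , (_ , pi<b)) lowest =
    convertible-from-margins homᵢ
      (balanced-left-margins (s≤s⁻¹ (0≤+m-+n⇒n≤m (nonneg i homᵢ)))) right
    where
    below-marked : ∀ {j} → lowerEnd j < lowerEnd i → j ∈ S
    below-marked {j} pj<pi = inhomMarked m j λ homⱼ → <⇒≱ pj<pi (lowest j homⱼ)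
    right : ∀ j → CrossesFromRight m j i → RightMargin i j
    right j (i<j , pj<pi) with lowerEnd j <? offset c r
    ... | yes pj<a =
        <-≤-trans Lj<a (upperMarks-mono (≤-trans a≤i (<⇒≤ i<j)))
      , λ i∈S → <-≤-trans (s≤s (<-≤-trans Lj<a (upperMarks-mono a≤i))) (upperMarks-step i∈S ≤-refl i<j)
      where
      Lj<a : lowerMarks (lowerEnd j) < upperMarks (offset c r)
      Lj<a = <-≤-trans (lowerMarks-step (below-marked pj<pi) ≤-refl pj<a) (≤-reflexive (sym (upperMarks≡lowerMarks-offset r)))
    ... | no pj≮a with toℕ j <? offset c (suc r)
    ...   | yes j<b = ⊥-elim (<⇒≱ pj<pi (lowest j
              (r , r<k , (≤-trans a≤i (<⇒≤ i<j) , j<b) , (≮⇒≥ pj≮a , <-trans pj<pi pi<b))))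
    ...   | no j≮b =
        <-≤-trans Lj<Li (≤-trans (lowerMarks-mono (<⇒≤ pi<b)) b≤j)
      , λ i∈S → <-≤-trans (s≤s Lj<Li) (≤-trans (lowerMarks-step i∈S ≤-refl pi<b) b≤j)
      where
      Lj<Li = lowerMarks-step (below-marked pj<pi) ≤-refl pj<pi
      b≤j : lowerMarks (offset c (suc r)) ≤ upperMarks (toℕ j)
      b≤j = ≤-trans (≤-reflexive (sym (upperMarks≡lowerMarks-offset (suc r)))) (upperMarks-mono (≮⇒≥ j≮b))

  first-negative-unmarked-convertible : ∀ {i} → Homogeneous c π i → bdiff m i ℤ.< 0ℤ →
    (∀ j → toℕ j < toℕ i → Homogeneous c π j → ¬ (bdiff m j ℤ.< 0ℤ)) →
    i ∉ S → Convertible m i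
  first-negative-unmarked-convertible {i} homᵢ@(r , r<k , (_ , i<b) , (a≤pi , _)) negᵢ first i∉S =
    convertible-from-margins homᵢ left right
    where
    left : ∀ j → CrossesFromLeft m j i → LeftMargin i j
    left j (j<i , pi<pj) = Uj≤Lj , λ i∈S → ⊥-elim (i∉S i∈S)
      where
      Uj≤Lj : upperMarks (toℕ j) ≤ lowerMarks (lowerEnd j)
      Uj≤Lj with toℕ j <? offset c r
      ... | yes j<a = upperMarks≤lowerMarks-across-offset r (<⇒≤ j<a) (≤-trans a≤pi (<⇒≤ pi<pj))
      ... | no j≮a with lowerEnd j <? offset c (suc r)
      ...   | yes pj<b = s≤s⁻¹ (0≤+m-+n⇒n≤m (ℤ.≮⇒≥ (first j j<i
                (r , r<k , (≮⇒≥ j≮a , <-trans j<i i<b) , (≤-trans a≤pi (<⇒≤ pi<pj) , pj<b)))))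
      ...   | no pj≮b = upperMarks≤lowerMarks-across-offset (suc r) (<⇒≤ (<-trans j<i i<b)) (≮⇒≥ pj≮b)
    right : ∀ j → CrossesFromRight m j i → RightMargin i j
    right j (i<j , pj<pi) =
        ≤-<-trans (lowerMarks-mono (<⇒≤ pj<pi)) (<-≤-trans (s≤s⁻¹ (+m-+n<0⇒m<n negᵢ)) (upperMarks-mono (<⇒≤ i<j)))
      , λ i∈S → ⊥-elim (i∉S i∈S)

  case2b-convertible : ∀ {i q} → Homogeneous c π i → bdiff m i ℤ.< 0ℤ →
    (∀ j → toℕ j < toℕ i → Homogeneous c π j → ¬ (bdiff m j ℤ.< 0ℤ)) →
    ¬ Convertible m i →
    toℕ q < toℕ i × Homogeneous c π q × bdiff m q ≡ 0ℤ × Crosses m q i →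
    (∀ j → toℕ j < toℕ i → Homogeneous c π j → bdiff m j ≡ 0ℤ → Crosses m j i → toℕ j ≤ toℕ q) →
    Convertible m q
  case2b-convertible {i} {q} homᵢ negᵢ first ¬convᵢ (q<i , homq , bdiff-q≡0 , q×i) last =
    convertible-from-margins homq (balanced-left-margins (≤-reflexive Uq≡Lq)) right
    where
    i∈S : i ∈ S
    i∈S = decidable-stable (i ∈? S) (¬convᵢ ∘ first-negative-unmarked-convertible homᵢ negᵢ first)
    Uq≡Lq : upperMarks (toℕ q) ≡ lowerMarks (lowerEnd q)
    Uq≡Lq = sym (suc-injective (+-injective (i-j≡0⇒i≡j _ _ bdiff-q≡0)))
    pi<pq : lowerEnd i < lowerEnd q
    pi<pq = [ proj₂ , (λ (i<q , _) → ⊥-elim (<-asym q<i i<q)) ] q×i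
    Lq≤Uj : ∀ {j} → toℕ q < toℕ j → lowerMarks (lowerEnd q) ≤ upperMarks (toℕ j)
    Lq≤Uj q<j = ≤-trans (≤-reflexive (sym Uq≡Lq)) (upperMarks-mono (<⇒≤ q<j))
    below-q : ∀ {j} → toℕ q < toℕ j → lowerMarks (lowerEnd j) < lowerMarks (lowerEnd q) → RightMargin q j
    below-q q<j Lj<Lq =
        <-≤-trans Lj<Lq (Lq≤Uj q<j)
      , λ q∈S → ≤-trans (s≤s (≤-trans Lj<Lq (≤-reflexive (sym Uq≡Lq)))) (upperMarks-step q∈S ≤-refl q<j)
    right : ∀ j → CrossesFromRight m j q → RightMargin q j
    right j (q<j , pj<pq) with j ∈? S
    ... | yes j∈S = below-q q<j (lowerMarks-step j∈S ≤-refl pj<pq)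
    ... | no j∉S with toℕ i <? toℕ j
    ...   | yes i<j =
        ≤-<-trans (≤-trans Lj≤Uq (upperMarks-mono (<⇒≤ q<i))) Ui<Uj
      , λ q∈S → ≤-trans (s≤s (≤-<-trans Lj≤Uq (upperMarks-step q∈S ≤-refl q<i))) Ui<Uj
      where
      Lj≤Uq = ≤-trans (lowerMarks-mono (<⇒≤ pj<pq)) (≤-reflexive (sym Uq≡Lq))
      Ui<Uj = upperMarks-step i∈S ≤-refl i<j
    ...   | no i≮j with lowerEnd j <? lowerEnd i
    ...     | yes pj<pi = below-q q<j (lowerMarks-step i∈S (<⇒≤ pj<pi) pi<pq)
    ...     | no pj≮pi = ⊥-elim (j∉S (inhomMarked m j ¬homⱼ))
      where
      j≢i : j ≢ i
      j≢i refl = j∉S i∈S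
      j<i = ≤∧≢⇒< (≮⇒≥ i≮j) (j≢i ∘ toℕ-injective)
      pi<pj = ≤∧≢⇒< (≮⇒≥ pj≮pi) (j≢i ∘ sym ∘ lowerEnd-injective)
      -- e_j would be a later balanced homogeneous edge crossing e_i than e_q.
      ¬homⱼ : ¬ Homogeneous c π j
      ¬homⱼ homⱼ = <⇒≱ q<j (last j j<i homⱼ bdiff-j≡0 (inj₁ (j<i , pi<pj)))
        where
        Uj≤Lj = s≤s⁻¹ (0≤+m-+n⇒n≤m (ℤ.≮⇒≥ (first j j<i homⱼ)))
        Lj≤Uj = ≤-trans (lowerMarks-mono (<⇒≤ pj<pq)) (Lq≤Uj q<j)
        bdiff-j≡0 = i≡j⇒i-j≡0 (cong (λ k → + suc k) (≤-antisym Lj≤Uj Uj≤Lj))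

  phi-edge-convertible : ∀ {e} → PhiEdge m e → Convertible m e
  phi-edge-convertible (case1 _ nonneg homₑ lowest)                 = case1-convertible nonneg homₑ lowest
  phi-edge-convertible (case2a _ _ _ _ convₑ)                       = convₑ
  phi-edge-convertible (case2b _ _ homᵢ negᵢ first ¬convᵢ e-props last) =
    case2b-convertible homᵢ negᵢ first ¬convᵢ e-props last

△-⁅⁆-injective : ∀ {n} (T : Subset n) {x y} → T △ ⁅ x ⁆ ≡ T △ ⁅ y ⁆ → x ≡ y
△-⁅⁆-injective (_ ∷ T)     {zero}  {zero}  _  = refl
△-⁅⁆-injective (true ∷ T)  {zero}  {suc y} ()
△-⁅⁆-injective (false ∷ T) {zero}  {suc y} ()
△-⁅⁆-injective (true ∷ T)  {suc x} {zero}  ()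
△-⁅⁆-injective (false ∷ T) {suc x} {zero}  ()
△-⁅⁆-injective (_ ∷ T)     {suc x} {suc y} eq = cong suc (△-⁅⁆-injective T (∷-injectiveʳ eq))

lemma4p4 : (c : Composition) (m : Marked c) →
           ∃ (Homogeneous c (perm m)) →
           (e : Fin (N c)) →
           Φ≡ m (marks m △ ⁅ e ⁆) →
           Convertible m e
lemma4p4 c m (i , homᵢ) e Φm = toggled-edge-convertible Φm refl
  where
  toggled-edge-convertible : ∀ {T} → Φ≡ m T → T ≡ marks m △ ⁅ e ⁆ → Convertible m e
  toggled-edge-convertible (case0 noneHomogeneous) _ = ⊥-elim (noneHomogeneous i homᵢ)
  toggled-edge-convertible (toggle x φ) T≡ =
    subst (Convertible m) (△-⁅⁆-injective (marks m) T≡) (phi-edge-convertible m φ)
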